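{- Let $n$ and $\sigma$ be integers with $2 \leq \sigma < \frac{n}{2}$. There is no deterministic algorithm that performs at most $\frac{n\sigma}{8}$ equality comparisons in the worst case and is able to distinguish length-$n$ strings with at most $\sigma$ distinct symbols from length-$n$ strings with at least $\frac{n}{2}$ distinct symbols.
   Context: The algorithm accesses the input string $T[1..n]$ over a general unordered alphabet only through queries "is $T[i]=T[j]$?"; each query counts as one equality comparison. -}

module Defs where

open import Data.Nat using (ℕ; zero; suc; _+_; _*_; _≤_)
open import Data.Bool using (Bool; true; false)
open import Data.Fin using (Fin)
open import Data.List using (List; length; tabulate; deduplicate)
open import Data.Product using (Σ; _×_)
open import Relation.Nullary using (yes; no)
open import Relation.Binary.Definitions using (DecidableEquality)
open import Relation.Binary.PropositionalEquality using (_≡_)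

-- A deterministic comparison-based algorithm on inputs of length n:
-- a binary decision tree whose internal nodes ask "is T[i] = T[j]?"
-- (left subtree on "yes", right subtree on "no") and whose leaves
-- output a Boolean answer.
data Algo (n : ℕ) : Set where
  answer : Bool → Algo n
  ask    : Fin n → Fin n → Algo n → Algo n → Algo n

run : ∀ {n} {A : Set} → DecidableEquality A → Algo n → (Fin n → A) → Bool
run _≟_ (answer b) T = b
run _≟_ (ask i j y m) T with T i ≟ T j
... | yes _ = run _≟_ y T
... | no  _ = run _≟_ m T

cost : ∀ {n} {A : Set} → DecidableEquality A → Algo n → (Fin n → A) → ℕ
cost _≟_ (answer b) T = zero
cost _≟_ (ask i j y m) T with T i ≟ T j
... | yes _ = suc (cost _≟_ y T)
... | no  _ = suc (cost _≟_ m T)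

distinct : ∀ {n} {A : Set} → DecidableEquality A → (Fin n → A) → ℕ
distinct _≟_ T = length (deduplicate _≟_ (tabulate T))

-- The algorithm performs at most n·σ/8 comparisons in the worst case
-- (over all alphabets and all input strings of length n), stated
-- without division as 8 · cost ≤ n · σ.
WithinBudget : ∀ {n} → ℕ → Algo n → Set₁
WithinBudget {n} σ alg =
  (A : Set) (_≟_ : DecidableEquality A) (T : Fin n → A) →
    8 * cost _≟_ alg T ≤ n * σ

Distinguishes : ∀ {n} → ℕ → Algo n → Set₁
Distinguishes {n} σ alg =
  (A : Set) (_≟_ : DecidableEquality A) (T : Fin n → A) →
    (distinct _≟_ T ≤ σ → run _≟_ alg T ≡ true) ×
    (n ≤ 2 * distinct _≟_ T → run _≟_ alg T ≡ false)

{-# OPTIONS --safe #-}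
module Submission where

-- An adversary answers a query T[i] = T[j]? with "no" unless the answer is
-- forced, and records every "no" as an edge between positions. A position is
-- coloured, with one of the colours 0 … s (σ = s + 1) not used by its neighbours,
-- as soon as it has s incident edges; queries between two positions of the same
-- colour are answered "yes". Uncoloured positions therefore have fewer than s
-- edges, and every input consistent with the transcript is processed the same
-- way. Two such inputs: colour the remaining positions greedily (at most σ
-- symbols), or give each remaining position a new symbol of its own. Each
-- coloured position has at least s edges, so with C comparisons
-- s · #coloured ≤ 2 · #edges ≤ 2C ≤ nσ/4 ≤ ns/2; thus at least n/2 positions
-- stay uncoloured and the second input has at least n/2 distinct symbols.

open import Defs
open import Data.Bool using (Bool; true; false; if_then_else_)
open import Data.Empty using (⊥; ⊥-elim)
open import Data.Fin using (Fin; zero; suc; toℕ)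
open import Data.Fin.Properties using (toℕ-injective) renaming (_≟_ to _≟ᶠ_)
open import Data.List
  using (List; []; _∷_; [_]; _++_; length; filter; map; mapMaybe; tabulate; upTo; allFin; deduplicate)
open import Data.List.Properties using (filter-notAll; length-upTo; length-++; length-map)
open import Data.List.Membership.Propositional using (_∈_; _∉_; find)
open import Data.List.Membership.Propositional.Properties
  using ( ∈-allFin; ∈-++⁺ˡ; ∈-++⁺ʳ; ∈-filter⁺; ∈-filter⁻; ∈-upTo⁺; ∈-upTo⁻; ∈-map⁻
        ; ∈-tabulate⁺; ∈-tabulate⁻; ∈-deduplicate⁺; ∈-deduplicate⁻)
open import Data.List.Relation.Binary.Subset.Propositional using (_⊆_)
open import Data.List.Relation.Unary.All using (All; all?)
import Data.List.Relation.Unary.All as All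
open import Data.List.Relation.Unary.All.Properties using (¬All⇒Any¬)
open import Data.List.Relation.Unary.Any using (here; there)
import Data.List.Relation.Unary.Any as Any
open import Data.List.Relation.Unary.AllPairs using (_∷_)
open import Data.List.Relation.Unary.Unique.Propositional using (Unique)
open import Data.List.Relation.Unary.Unique.Propositional.Properties using (upTo⁺; map⁺; filter⁺; allFin⁺)
open import Data.Maybe using (Maybe; just; nothing; fromMaybe)
open import Data.Maybe.Properties using (≡-dec; just-injective)
open import Data.Nat using (ℕ; zero; suc; _+_; _*_; _≤_; _<_; z≤n; s≤s)
open import Data.Nat.Properties
open import Algebra.Properties.Semiring.Sum +-*-semiring
  using (sum; ∑-distrib-+; *-distribˡ-sum; sum-cong-≗; sum-replicate-zero)
open import Data.List.Membership.DecPropositional _≟_ using (_∈?_)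
open import Data.Nat.Tactic.RingSolver using (solve-∀)
open import Data.Product using (Σ; ∃; _×_; _,_; proj₁; proj₂)
import Data.Product as Product
open import Data.Sum using (_⊎_; inj₁; inj₂)
open import Function using (_∘_; id; case_of_)
open import Relation.Binary.Definitions using (DecidableEquality)
open import Relation.Binary.PropositionalEquality
  using (_≡_; _≢_; refl; sym; trans; cong; cong₂; subst; module ≡-Reasoning)
open import Relation.Nullary using (Dec; yes; no; does; ¬_; ¬?; _⊎-dec_; _×-dec_)
open import Relation.Unary using (Decidable)

Unique⇒length≤ : ∀ {A : Set} → DecidableEquality A →
                 ∀ {xs ys : List A} → Unique xs → xs ⊆ ys → length xs ≤ length ys
Unique⇒length≤ _≟ᴬ_ {[]}     _               _     = z≤n
Unique⇒length≤ _≟ᴬ_ {x ∷ xs} {ys} (x∉xs ∷ xs!) xs⊆ys =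
  ≤-trans (s≤s (Unique⇒length≤ _≟ᴬ_ xs! xs⊆others)) (filter-notAll others? ys x∈ys)
  where
  others? = λ y → ¬? (x ≟ᴬ y)
  x∈ys = Any.map (λ x≡y x≢y → x≢y x≡y) (xs⊆ys (here refl))
  xs⊆others : xs ⊆ filter others? ys
  xs⊆others y∈xs = ∈-filter⁺ others? (xs⊆ys (there y∈xs)) (All.lookup x∉xs y∈xs)

fresh : (xs : List ℕ) → Σ ℕ λ c → c ∉ xs × c ≤ length xs
fresh xs with all? (_∈? xs) (upTo (suc (length xs)))
... | yes all∈ = ⊥-elim (1+n≰n {length xs} (subst (_≤ length xs) (length-upTo _)
                   (Unique⇒length≤ _≟_ (upTo⁺ _) (All.lookup all∈))))
... | no ¬all∈ with c , c∈ , c∉ ← find (¬All⇒Any¬ (_∈? xs) _ ¬all∈) = c , c∉ , ≤-pred (∈-upTo⁻ c∈)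

length-mapMaybe-≤ : ∀ {A B : Set} (f : A → Maybe B) (xs : List A) →
                    length (mapMaybe f xs) ≤ length xs
length-mapMaybe-≤ f []       = z≤n
length-mapMaybe-≤ f (x ∷ xs) with f x
... | just _  = s≤s (length-mapMaybe-≤ f xs)
... | nothing = m≤n⇒m≤1+n (length-mapMaybe-≤ f xs)

∈-mapMaybe⁺ : ∀ {A B : Set} (f : A → Maybe B) {x y} {xs : List A} →
              x ∈ xs → f x ≡ just y → y ∈ mapMaybe f xs
∈-mapMaybe⁺ f {x} (here refl) fx≡y with f x
∈-mapMaybe⁺ f (here refl) refl | just _ = here refl
∈-mapMaybe⁺ f {xs = x′ ∷ _} (there x∈) fx≡y with f x′
... | just _  = there (∈-mapMaybe⁺ f x∈ fx≡y)
... | nothing = ∈-mapMaybe⁺ f x∈ fx≡y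

fromMaybe-just : ∀ {A : Set} {d c : A} {x : Maybe A} → x ≡ just c → fromMaybe d x ≡ c
fromMaybe-just refl = refl

χ : ∀ {P : Set} → Dec P → ℕ
χ P? = if does P? then 1 else 0

χ+χ¬≡1 : ∀ {P : Set} (P? : Dec P) → χ P? + χ (¬? P?) ≡ 1
χ+χ¬≡1 (yes _) = refl
χ+χ¬≡1 (no _)  = refl

χ≡0 : ∀ {P : Set} (P? : Dec P) → ¬ P → χ P? ≡ 0
χ≡0 (yes p) ¬p = ⊥-elim (¬p p)
χ≡0 (no _)  _  = refl

onlyIf : ∀ {P A : Set} → Dec P → A → List A
onlyIf P? x = if does P? then [ x ] else []

length-onlyIf : ∀ {P A : Set} (P? : Dec P) (x : A) → length (onlyIf P? x) ≡ χ P?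
length-onlyIf (yes _) x = refl
length-onlyIf (no _)  x = refl

∈-onlyIf : ∀ {P A : Set} (P? : Dec P) (x : A) → P → x ∈ onlyIf P? x
∈-onlyIf (yes _) x _  = here refl
∈-onlyIf (no ¬p) x p  = ⊥-elim (¬p p)

sum-mono-≤ : ∀ {m} {f g : Fin m → ℕ} → (∀ i → f i ≤ g i) → sum f ≤ sum g
sum-mono-≤ {zero}  f≤g = z≤n
sum-mono-≤ {suc m} f≤g = +-mono-≤ (f≤g zero) (sum-mono-≤ (f≤g ∘ suc))

sum-ones : ∀ m → sum {m} (λ _ → 1) ≡ m
sum-ones zero    = refl
sum-ones (suc m) = cong suc (sum-ones m)

sum-δ : ∀ {m} (i : Fin m) → sum (λ v → χ (v ≟ᶠ i)) ≡ 1
sum-δ {suc m} zero    = cong suc (sum-replicate-zero m)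
sum-δ {suc m} (suc i) = sum-δ i

length-filter-tabulate : ∀ {m} {A : Set} {P : A → Set} (P? : Decidable P) (f : Fin m → A) →
                         length (filter P? (tabulate f)) ≡ sum (λ v → χ (P? (f v)))
length-filter-tabulate {zero}  P? f = refl
length-filter-tabulate {suc m} P? f with P? (f zero)
... | yes _ = cong suc (length-filter-tabulate P? (f ∘ suc))
... | no  _ = length-filter-tabulate P? (f ∘ suc)

distinct-≤ : ∀ {n b} (T : Fin n → ℕ) → (∀ v → T v < b) → distinct _≟_ T ≤ b
distinct-≤ {b = b} T T<b =
  subst (distinct _≟_ T ≤_) (length-upTo b) (Unique⇒length≤ _≟_ (deduplicate-! (tabulate T)) values⊆)
  where
  open import Data.List.Relation.Unary.Unique.DecPropositional.Properties _≟_ using (deduplicate-!)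
  values⊆ : deduplicate _≟_ (tabulate T) ⊆ upTo b
  values⊆ t∈ with v , refl ← ∈-tabulate⁻ (∈-deduplicate⁻ _≟_ (tabulate T) t∈) = ∈-upTo⁺ (T<b v)

module _ {A : Set} (_≟ᴬ_ : DecidableEquality A) where

  open import Data.List.Relation.Unary.Unique.DecPropositional.Properties _≟ᴬ_ using (deduplicate-!)

  ∑χ≤distinct : ∀ {n} {P : Fin n → Set} (P? : Decidable P) (T g : Fin n → A) →
                (∀ {v w} → g v ≡ g w → v ≡ w) → (∀ v → P v → T v ≡ g v) →
                sum (λ v → χ (P? v)) ≤ distinct _≟ᴬ_ T
  ∑χ≤distinct {n} P? T g g-injective T≡g = begin
    sum (λ v → χ (P? v))                  ≡⟨ length-filter-tabulate P? id ⟨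
    length (filter P? (allFin n))         ≡⟨ length-map g (filter P? (allFin n)) ⟨
    length (map g (filter P? (allFin n))) ≤⟨ Unique⇒length≤ _≟ᴬ_ g[P]! g[P]⊆ ⟩
    distinct _≟ᴬ_ T                       ∎
    where
    open ≤-Reasoning
    g[P]! = map⁺ g-injective (filter⁺ P? (allFin⁺ n))
    g[P]⊆ : map g (filter P? (allFin n)) ⊆ deduplicate _≟ᴬ_ (tabulate T)
    g[P]⊆ t∈ with v , v∈ , refl ← ∈-map⁻ g t∈ with _ , Pv ← ∈-filter⁻ P? {xs = allFin n} v∈ =
      ∈-deduplicate⁺ _≟ᴬ_ (subst (_∈ tabulate T) (T≡g v Pv) (∈-tabulate⁺ v))

2a≤n : ∀ {s a e n} → 0 < s → s * a ≤ 2 * e → 8 * e ≤ n * suc s → 2 * a ≤ n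
2a≤n {s@(suc _)} {a} {e} {n} 0<s sa≤2e 8e≤n[s+1] = *-cancelˡ-≤ (2 * s) (begin
  2 * s * (2 * a)  ≡⟨ reassoc s a ⟩
  4 * (s * a)      ≤⟨ *-monoʳ-≤ 4 sa≤2e ⟩
  4 * (2 * e)      ≡⟨ *-assoc 4 2 e ⟨
  8 * e            ≤⟨ 8e≤n[s+1] ⟩
  n * suc s        ≤⟨ *-monoʳ-≤ n (+-monoˡ-≤ s 0<s) ⟩
  n * (s + s)      ≡⟨ reorder n s ⟩
  2 * s * n        ∎)
  where
  open ≤-Reasoning
  reassoc : ∀ s a → 2 * s * (2 * a) ≡ 4 * (s * a)
  reassoc = solve-∀
  reorder : ∀ n s → n * (s + s) ≡ 2 * s * n
  reorder = solve-∀

n≤2u : ∀ {u a n} → u + a ≡ n → 2 * a ≤ n → n ≤ 2 * u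
n≤2u {u} {a} refl 2a≤u+a = begin
  u + a  ≤⟨ +-monoʳ-≤ u a≤u ⟩
  u + u  ≡⟨ cong (u +_) (+-identityʳ u) ⟨
  2 * u  ∎
  where
  open ≤-Reasoning
  a≤u = +-cancelʳ-≤ a a u (subst (_≤ u + a) (cong (a +_) (+-identityʳ a)) 2a≤u+a)

Edge : ℕ → Set
Edge n = Fin n × Fin n

neighbours : ∀ {n} → List (Edge n) → Fin n → List (Fin n)
neighbours []            v = []
neighbours ((i , j) ∷ E) v = onlyIf (v ≟ᶠ i) j ++ onlyIf (v ≟ᶠ j) i ++ neighbours E v

degree : ∀ {n} → List (Edge n) → Fin n → ℕ
degree E v = length (neighbours E v)

module _ {n : ℕ} where

  degree-∷ : ∀ i j (E : List (Edge n)) v →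
             degree ((i , j) ∷ E) v ≡ χ (v ≟ᶠ i) + χ (v ≟ᶠ j) + degree E v
  degree-∷ i j E v = begin
    length (onlyIf (v ≟ᶠ i) j ++ onlyIf (v ≟ᶠ j) i ++ neighbours E v)
      ≡⟨ length-++ (onlyIf (v ≟ᶠ i) j) ⟩
    length (onlyIf (v ≟ᶠ i) j) + length (onlyIf (v ≟ᶠ j) i ++ neighbours E v)
      ≡⟨ cong₂ _+_ (length-onlyIf (v ≟ᶠ i) j) (length-++ (onlyIf (v ≟ᶠ j) i)) ⟩
    χ (v ≟ᶠ i) + (length (onlyIf (v ≟ᶠ j) i) + degree E v)
      ≡⟨ cong (λ d → χ (v ≟ᶠ i) + (d + degree E v)) (length-onlyIf (v ≟ᶠ j) i) ⟩
    χ (v ≟ᶠ i) + (χ (v ≟ᶠ j) + degree E v)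
      ≡⟨ +-assoc (χ (v ≟ᶠ i)) _ _ ⟨
    χ (v ≟ᶠ i) + χ (v ≟ᶠ j) + degree E v ∎
    where open ≡-Reasoning

  ∈-neighboursˡ : ∀ {E : List (Edge n)} {i j} → (i , j) ∈ E → j ∈ neighbours E i
  ∈-neighboursˡ {(i , j) ∷ E} (here refl) = ∈-++⁺ˡ (∈-onlyIf (i ≟ᶠ i) j refl)
  ∈-neighboursˡ {(a , b) ∷ E} {i} (there e∈) =
    ∈-++⁺ʳ (onlyIf (i ≟ᶠ a) b) (∈-++⁺ʳ (onlyIf (i ≟ᶠ b) a) (∈-neighboursˡ e∈))

  ∈-neighboursʳ : ∀ {E : List (Edge n)} {i j} → (i , j) ∈ E → i ∈ neighbours E j
  ∈-neighboursʳ {(i , j) ∷ E} (here refl) =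
    ∈-++⁺ʳ (onlyIf (j ≟ᶠ i) j) (∈-++⁺ˡ (∈-onlyIf (j ≟ᶠ j) i refl))
  ∈-neighboursʳ {(a , b) ∷ E} {j = j} (there e∈) =
    ∈-++⁺ʳ (onlyIf (j ≟ᶠ a) b) (∈-++⁺ʳ (onlyIf (j ≟ᶠ b) a) (∈-neighboursʳ e∈))

  degree-≤-∷ : ∀ e (E : List (Edge n)) v → degree E v ≤ degree (e ∷ E) v
  degree-≤-∷ (i , j) E v = subst (degree E v ≤_) (sym (degree-∷ i j E v)) (m≤n+m _ _)

  degree-∷-≤ : ∀ {i j} → i ≢ j → ∀ (E : List (Edge n)) v → degree ((i , j) ∷ E) v ≤ suc (degree E v)
  degree-∷-≤ {i} {j} i≢j E v = subst (_≤ suc (degree E v)) (sym (degree-∷ i j E v))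
                                     (+-monoˡ-≤ (degree E v) (at-most-one-endpoint (v ≟ᶠ i) (v ≟ᶠ j)))
    where
    at-most-one-endpoint : (v≟i : Dec (v ≡ i)) (v≟j : Dec (v ≡ j)) → χ v≟i + χ v≟j ≤ 1
    at-most-one-endpoint (yes refl) (yes refl) = ⊥-elim (i≢j refl)
    at-most-one-endpoint (yes _)    (no _)     = ≤-refl
    at-most-one-endpoint (no _)     (yes _)    = ≤-refl
    at-most-one-endpoint (no _)     (no _)     = z≤n

  degree-∷-≢ : ∀ {i j v} → v ≢ i → v ≢ j → ∀ (E : List (Edge n)) → degree ((i , j) ∷ E) v ≡ degree E v
  degree-∷-≢ {i} {j} {v} v≢i v≢j E = trans (degree-∷ i j E v)
    (cong₂ (λ a b → a + b + degree E v) (χ≡0 (v ≟ᶠ i) v≢i) (χ≡0 (v ≟ᶠ j) v≢j))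

  sum-degree : (E : List (Edge n)) → sum (degree E) ≡ 2 * length E
  sum-degree []            = sum-replicate-zero n
  sum-degree ((i , j) ∷ E) = begin
    sum (degree ((i , j) ∷ E))
      ≡⟨ sum-cong-≗ (degree-∷ i j E) ⟩
    sum (λ v → χ (v ≟ᶠ i) + χ (v ≟ᶠ j) + degree E v)
      ≡⟨ ∑-distrib-+ (λ v → χ (v ≟ᶠ i) + χ (v ≟ᶠ j)) (degree E) ⟩
    sum (λ v → χ (v ≟ᶠ i) + χ (v ≟ᶠ j)) + sum (degree E)
      ≡⟨ cong₂ _+_ (∑-distrib-+ (λ v → χ (v ≟ᶠ i)) (λ v → χ (v ≟ᶠ j))) (sum-degree E) ⟩
    sum (λ v → χ (v ≟ᶠ i)) + sum (λ v → χ (v ≟ᶠ j)) + 2 * length E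
      ≡⟨ cong (_+ 2 * length E) (cong₂ _+_ (sum-δ i) (sum-δ j)) ⟩
    2 + 2 * length E
      ≡⟨ *-distribˡ-+ 2 1 (length E) ⟨
    2 * length ((i , j) ∷ E) ∎
    where open ≡-Reasoning

SameColour : Maybe ℕ → Maybe ℕ → Set
SameColour x y = ∃ λ c → x ≡ just c × y ≡ just c

sameColour? : (x y : Maybe ℕ) → Dec (SameColour x y)
sameColour? nothing  _        = no λ { (_ , () , _) }
sameColour? (just a) nothing  = no λ { (_ , _ , ()) }
sameColour? (just a) (just b) with a ≟ b
... | yes refl = yes (a , refl , refl)
... | no a≢b   = no λ { (_ , refl , refl) → a≢b refl }

module Adversary (n s : ℕ) where

  Colouring : Set
  Colouring = Fin n → Maybe ℕ

  Forced : Colouring → Fin n → Fin n → Set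
  Forced col i j = i ≡ j ⊎ SameColour (col i) (col j)

  forced? : ∀ col i j → Dec (Forced col i j)
  forced? col i j = (i ≟ᶠ j) ⊎-dec sameColour? (col i) (col j)

  Proper : List (Edge n) → Colouring → Set
  Proper E col = ∀ {i j} → (i , j) ∈ E → ¬ Forced col i j

  Bounded : Colouring → Set
  Bounded col = ∀ {v c} → col v ≡ just c → c ≤ s

  _⊑_ : Colouring → Colouring → Set
  col ⊑ col′ = ∀ {v c} → col v ≡ just c → col′ v ≡ just c

  ⊑-trans : ∀ {col₁ col₂ col₃} → col₁ ⊑ col₂ → col₂ ⊑ col₃ → col₁ ⊑ col₃
  ⊑-trans ⊑₁ ⊑₂ cv = ⊑₂ (⊑₁ cv)

  Uncoloured : Colouring → Fin n → Set
  Uncoloured col v = col v ≡ nothing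

  uncoloured? : ∀ col → Decidable (Uncoloured col)
  uncoloured? col v = ≡-dec _≟_ (col v) nothing

  setColour : Colouring → Fin n → ℕ → Colouring
  setColour col v c w = if does (w ≟ᶠ v) then just c else col w

  setColour-just : ∀ col v c {w d} → setColour col v c w ≡ just d → (w ≡ v × d ≡ c) ⊎ col w ≡ just d
  setColour-just col v c {w} eq with w ≟ᶠ v
  ... | yes w≡v = inj₁ (w≡v , sym (just-injective eq))
  ... | no _    = inj₂ eq

  module _ (E : List (Edge n)) where

    freshColour : Colouring → Fin n → ℕ
    freshColour col v = proj₁ (fresh (mapMaybe col (neighbours E v)))

    freshColour-∉ : ∀ col v → freshColour col v ∉ mapMaybe col (neighbours E v)
    freshColour-∉ col v = proj₁ (proj₂ (fresh (mapMaybe col (neighbours E v))))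

    freshColour-≤ : ∀ col v → freshColour col v ≤ degree E v
    freshColour-≤ col v =
      ≤-trans (proj₂ (proj₂ (fresh (mapMaybe col (neighbours E v))))) (length-mapMaybe-≤ col (neighbours E v))

    paint : Colouring → Fin n → Colouring
    paint col v = setColour col v (freshColour col v)

    paint-proper : ∀ {col} v → Proper E col → Proper E (paint col v)
    paint-proper v proper e∈ (inj₁ i≡j) = proper e∈ (inj₁ i≡j)
    paint-proper {col} v proper {i} {j} e∈ (inj₂ (c , ci , cj))
      with setColour-just col v _ ci | setColour-just col v _ cj
    ... | inj₁ (refl , _)    | inj₁ (refl , _)    = proper e∈ (inj₁ refl)
    ... | inj₁ (refl , refl) | inj₂ cj′           = freshColour-∉ col i (∈-mapMaybe⁺ col (∈-neighboursˡ e∈) cj′)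
    ... | inj₂ ci′           | inj₁ (refl , refl) = freshColour-∉ col j (∈-mapMaybe⁺ col (∈-neighboursʳ e∈) ci′)
    ... | inj₂ ci′           | inj₂ cj′           = proper e∈ (inj₂ (c , ci′ , cj′))

    paint-bounded : ∀ {col} v → Bounded col → degree E v ≤ s → Bounded (paint col v)
    paint-bounded {col} v bounded deg≤s cw with setColour-just col v _ cw
    ... | inj₁ (refl , refl) = ≤-trans (freshColour-≤ col v) deg≤s
    ... | inj₂ cw′           = bounded cw′

    paint-⊑ : ∀ {col v} → Uncoloured col v → col ⊑ paint col v
    paint-⊑ {col} {v} unc {w} cw with w ≟ᶠ v
    ... | yes refl = case trans (sym unc) cw of λ ()
    ... | no _     = cw

    paintIfDegree≥ : ℕ → Colouring → Fin n → Colouring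
    paintIfDegree≥ t col v with uncoloured? col v ×-dec t ≤? degree E v
    ... | yes _ = paint col v
    ... | no  _ = col

    paintIfDegree≥-proper : ∀ t {col} v → Proper E col → Proper E (paintIfDegree≥ t col v)
    paintIfDegree≥-proper t {col} v proper with uncoloured? col v ×-dec t ≤? degree E v
    ... | yes _ = paint-proper v proper
    ... | no  _ = proper

    paintIfDegree≥-bounded : ∀ t {col} v → Bounded col → (Uncoloured col v → degree E v ≤ s) →
                             Bounded (paintIfDegree≥ t col v)
    paintIfDegree≥-bounded t {col} v bounded deg≤s with uncoloured? col v ×-dec t ≤? degree E v
    ... | yes (unc , _) = paint-bounded v bounded (deg≤s unc)
    ... | no  _         = bounded

    paintIfDegree≥-⊑ : ∀ t col v → col ⊑ paintIfDegree≥ t col v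
    paintIfDegree≥-⊑ t col v with uncoloured? col v ×-dec t ≤? degree E v
    ... | yes (unc , _) = paint-⊑ {col} {v} unc
    ... | no  _         = id

    paintIfDegree≥-uncoloured : ∀ t col v {w} → Uncoloured (paintIfDegree≥ t col v) w →
                                Uncoloured col w × (w ≡ v → degree E w < t)
    paintIfDegree≥-uncoloured t col v {w} unc with uncoloured? col v ×-dec t ≤? degree E v
    ... | no ¬paintable = unc , λ { refl → ≰⇒> (λ t≤ → ¬paintable (unc , t≤)) }
    ... | yes _ with w ≟ᶠ v
    ...   | yes refl = case unc of λ ()
    ...   | no w≢v   = unc , λ w≡v → ⊥-elim (w≢v w≡v)

    paintIfDegree≥-coloured : ∀ t col v {w c} → paintIfDegree≥ t col v w ≡ just c →
                              col w ≡ just c ⊎ t ≤ degree E w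
    paintIfDegree≥-coloured t col v cw with uncoloured? col v ×-dec t ≤? degree E v
    ... | no  _        = inj₁ cw
    ... | yes (_ , t≤) with setColour-just col v _ cw
    ...   | inj₁ (refl , _) = inj₂ t≤
    ...   | inj₂ cw′        = inj₁ cw′

    paintAll : Colouring → List (Fin n) → Colouring
    paintAll col []       = col
    paintAll col (v ∷ vs) = paintAll (paintIfDegree≥ 0 col v) vs

    paintAll-proper : ∀ {col} vs → Proper E col → Proper E (paintAll col vs)
    paintAll-proper []       proper = proper
    paintAll-proper (v ∷ vs) proper = paintAll-proper vs (paintIfDegree≥-proper 0 v proper)

    paintAll-bounded : ∀ {col} vs → Bounded col → (∀ {v} → Uncoloured col v → degree E v ≤ s) →
                       Bounded (paintAll col vs)
    paintAll-bounded []       bounded deg≤s = bounded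
    paintAll-bounded {col} (v ∷ vs) bounded deg≤s =
      paintAll-bounded vs (paintIfDegree≥-bounded 0 v bounded deg≤s)
        (λ {w} unc → deg≤s (proj₁ (paintIfDegree≥-uncoloured 0 col v {w} unc)))

    paintAll-⊑ : ∀ col vs → col ⊑ paintAll col vs
    paintAll-⊑ col []       = id
    paintAll-⊑ col (v ∷ vs) = ⊑-trans {col₂ = col′} (paintIfDegree≥-⊑ 0 col v) (paintAll-⊑ col′ vs)
      where col′ = paintIfDegree≥ 0 col v

    paintAll-colours : ∀ col {vs v} → v ∈ vs → ∃ λ c → paintAll col vs v ≡ just c
    paintAll-colours col {v ∷ vs} (here refl) with paintIfDegree≥ 0 col v v in cv
    ... | just c  = c , paintAll-⊑ (paintIfDegree≥ 0 col v) vs cv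
    ... | nothing with () ← proj₂ (paintIfDegree≥-uncoloured 0 col v cv) refl
    paintAll-colours col {w ∷ vs} (there v∈) = paintAll-colours (paintIfDegree≥ 0 col w) v∈

  record State : Set where
    field
      colour : Colouring
      edges  : List (Edge n)
  open State public

  empty : State
  empty = record { colour = λ _ → nothing ; edges = [] }

  separate : State → Fin n → Fin n → State
  separate S i j = record { colour = paintIfDegree≥ E s (paintIfDegree≥ E s (colour S) i) j
                          ; edges  = E }
    where E = (i , j) ∷ edges S

  _≼_ : State → State → Set
  S ≼ S′ = colour S ⊑ colour S′ × edges S ⊆ edges S′

  ≼-trans : ∀ {S₁ S₂ S₃} → S₁ ≼ S₂ → S₂ ≼ S₃ → S₁ ≼ S₃
  ≼-trans {S₂ = S₂} (⊑₁ , ⊆₁) (⊑₂ , ⊆₂) = ⊑-trans {col₂ = colour S₂} ⊑₁ ⊑₂ , ⊆₂ ∘ ⊆₁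

  ≼-separate : ∀ S i j → S ≼ separate S i j
  ≼-separate S i j = ⊑-trans {col₂ = col₁} (paintIfDegree≥-⊑ E s (colour S) i) (paintIfDegree≥-⊑ E s col₁ j)
                   , there
    where
    E = (i , j) ∷ edges S
    col₁ = paintIfDegree≥ E s (colour S) i

  record Transcript : Set where
    field
      final   : State
      output  : Bool
      queries : ℕ
  open Transcript public

  oneMoreQuery : Transcript → Transcript
  oneMoreQuery t = record t { queries = suc (queries t) }

  play : Algo n → State → Transcript
  play (answer b)    S = record { final = S ; output = b ; queries = 0 }
  play (ask i j y m) S with forced? (colour S) i j
  ... | yes _ = oneMoreQuery (play y S)
  ... | no  _ = oneMoreQuery (play m (separate S i j))

  ≼-play : ∀ alg S → S ≼ final (play alg S)
  ≼-play (answer b)    S = id , id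
  ≼-play (ask i j y m) S with forced? (colour S) i j
  ... | yes _ = ≼-play y S
  ... | no  _ = ≼-trans (≼-separate S i j) (≼-play m (separate S i j))

  length-edges-play : ∀ alg S →
                      length (edges (final (play alg S))) ≤ length (edges S) + queries (play alg S)
  length-edges-play (answer b)    S = m≤m+n _ _
  length-edges-play (ask i j y m) S with forced? (colour S) i j
  ... | yes _ = ≤-trans (length-edges-play y S) (+-monoʳ-≤ (length (edges S)) (n≤1+n _))
  ... | no  _ = begin
    length (edges (final (play m S′)))               ≤⟨ length-edges-play m S′ ⟩
    suc (length (edges S)) + queries (play m S′)     ≡⟨ +-suc (length (edges S)) _ ⟨
    length (edges S) + suc (queries (play m S′))     ∎
    where
    open ≤-Reasoning
    S′ = separate S i j

  record Realises (T : Fin n → ℕ) (S : State) : Set where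
    field
      agrees    : ∀ {v c} → colour S v ≡ just c → T v ≡ c
      separates : ∀ {i j} → (i , j) ∈ edges S → T i ≢ T j

  Realises-≼ : ∀ {T S S′} → S ≼ S′ → Realises T S′ → Realises T S
  Realises-≼ (⊑′ , ⊆′) R = record { agrees = agrees ∘ ⊑′ ; separates = separates ∘ ⊆′ }
    where open Realises R

  Realises-forced : ∀ {T S i j} → Realises T S → Forced (colour S) i j → T i ≡ T j
  Realises-forced R (inj₁ refl)          = refl
  Realises-forced R (inj₂ (c , ci , cj)) = trans (agrees ci) (sym (agrees cj))
    where open Realises R

  play-realises : ∀ alg S {T} → Realises T (final (play alg S)) →
                  run _≟_ alg T ≡ output (play alg S) × cost _≟_ alg T ≡ queries (play alg S)
  play-realises (answer b) S R = refl , refl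
  play-realises (ask i j y m) S {T} R with forced? (colour S) i j | T i ≟ T j
  ... | yes _      | yes _     = Product.map id (cong suc) (play-realises y S R)
  ... | yes forced | no Ti≢Tj  = ⊥-elim (Ti≢Tj (Realises-forced (Realises-≼ (≼-play y S) R) forced))
  ... | no  _      | yes Ti≡Tj =
    ⊥-elim (Realises.separates (Realises-≼ (≼-play m (separate S i j)) R) (here refl) Ti≡Tj)
  ... | no  _      | no  _     = Product.map id (cong suc) (play-realises m (separate S i j) R)

  record Invariant (S : State) : Set where
    field
      proper  : Proper (edges S) (colour S)
      bounded : Bounded (colour S)
      light   : ∀ {v} → Uncoloured (colour S) v → degree (edges S) v < s
      heavy   : ∀ {v c} → colour S v ≡ just c → s ≤ degree (edges S) v

  empty-invariant : 0 < s → Invariant empty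
  empty-invariant 0<s = record
    { proper  = λ ()
    ; bounded = λ ()
    ; light   = λ _ → 0<s
    ; heavy   = λ ()
    }

  separate-invariant : ∀ {S i j} → Invariant S → ¬ Forced (colour S) i j → Invariant (separate S i j)
  separate-invariant {S} {i} {j} inv ¬forced = record
    { proper  = paintIfDegree≥-proper E s j (paintIfDegree≥-proper E s i proper₀)
    ; bounded = paintIfDegree≥-bounded E s j bounded₁
                  (uncoloured⇒degree≤s ∘ proj₁ ∘ paintIfDegree≥-uncoloured E s (colour S) i)
    ; light   = light₂
    ; heavy   = heavy₂
    }
    where
    open Invariant inv
    E = (i , j) ∷ edges S
    col₁ = paintIfDegree≥ E s (colour S) i
    col₂ = paintIfDegree≥ E s col₁ j

    proper₀ : Proper E (colour S)
    proper₀ (here refl) = ¬forced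
    proper₀ (there e∈)  = proper e∈

    uncoloured⇒degree≤s : ∀ {v} → Uncoloured (colour S) v → degree E v ≤ s
    uncoloured⇒degree≤s {v} unc = ≤-trans (degree-∷-≤ (¬forced ∘ inj₁) (edges S) v) (light unc)

    bounded₁ : Bounded col₁
    bounded₁ = paintIfDegree≥-bounded E s i bounded uncoloured⇒degree≤s

    light₂ : ∀ {v} → Uncoloured col₂ v → degree E v < s
    light₂ {v} unc₂ = endpoint-cases (v ≟ᶠ i) (v ≟ᶠ j)
      where
      j-skipped = paintIfDegree≥-uncoloured E s col₁ j unc₂
      i-skipped = paintIfDegree≥-uncoloured E s (colour S) i (proj₁ j-skipped)
      endpoint-cases : Dec (v ≡ i) → Dec (v ≡ j) → degree E v < s
      endpoint-cases (yes v≡i) _         = proj₂ i-skipped v≡i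
      endpoint-cases (no _)    (yes v≡j) = proj₂ j-skipped v≡j
      endpoint-cases (no v≢i)  (no v≢j)  =
        subst (_< s) (sym (degree-∷-≢ v≢i v≢j (edges S))) (light (proj₁ i-skipped))

    heavy₂ : ∀ {v c} → col₂ v ≡ just c → s ≤ degree E v
    heavy₂ {v} cv₂ with paintIfDegree≥-coloured E s col₁ j cv₂
    ... | inj₂ s≤ = s≤
    ... | inj₁ cv₁ with paintIfDegree≥-coloured E s (colour S) i cv₁
    ...   | inj₂ s≤  = s≤
    ...   | inj₁ cv₀ = ≤-trans (heavy cv₀) (degree-≤-∷ (i , j) (edges S) v)

  play-invariant : ∀ alg {S} → Invariant S → Invariant (final (play alg S))
  play-invariant (answer b)    inv = inv
  play-invariant (ask i j y m) {S} inv with forced? (colour S) i j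
  ... | yes _      = play-invariant y inv
  ... | no ¬forced = play-invariant m (separate-invariant inv ¬forced)

  completeGreedily : State → Fin n → ℕ
  completeGreedily S v = fromMaybe 0 (paintAll (edges S) (colour S) (allFin n) v)

  completeFreshly : State → Fin n → ℕ
  completeFreshly S v = fromMaybe (suc s + toℕ v) (colour S v)

  uncolouredCount colouredCount : State → ℕ
  uncolouredCount S = sum (λ v → χ (uncoloured? (colour S) v))
  colouredCount   S = sum (λ v → χ (¬? (uncoloured? (colour S) v)))

  uncoloured+coloured : ∀ S → uncolouredCount S + colouredCount S ≡ n
  uncoloured+coloured S = begin
    uncolouredCount S + colouredCount S       ≡⟨ ∑-distrib-+ (χ ∘ unc?) (χ ∘ ¬? ∘ unc?) ⟨
    sum (λ v → χ (unc? v) + χ (¬? (unc? v)))  ≡⟨ sum-cong-≗ (χ+χ¬≡1 ∘ unc?) ⟩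
    sum {n} (λ _ → 1)                         ≡⟨ sum-ones n ⟩
    n                                         ∎
    where
    open ≡-Reasoning
    unc? = uncoloured? (colour S)

  uncolouredCount-≤ : ∀ S → uncolouredCount S ≤ distinct _≟_ (completeFreshly S)
  uncolouredCount-≤ S =
    ∑χ≤distinct _≟_ (uncoloured? (colour S)) (completeFreshly S) (λ v → suc s + toℕ v)
      (toℕ-injective ∘ +-cancelˡ-≡ (suc s) _ _) (λ v → cong (fromMaybe (suc s + toℕ v)))

  module _ {S : State} (inv : Invariant S) where

    open Invariant inv

    private
      greedy = paintAll (edges S) (colour S) (allFin n)
      greedy-colours : ∀ v → ∃ λ c → greedy v ≡ just c
      greedy-colours v = paintAll-colours (edges S) (colour S) (∈-allFin v)
      greedy-bounded : Bounded greedy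
      greedy-bounded = paintAll-bounded (edges S) (allFin n) bounded (<⇒≤ ∘ light)

    completeGreedily-realises : Realises (completeGreedily S) S
    completeGreedily-realises = record
      { agrees    = fromMaybe-just ∘ paintAll-⊑ (edges S) (colour S) (allFin n)
      ; separates = separates
      }
      where
      separates : ∀ {i j} → (i , j) ∈ edges S → completeGreedily S i ≢ completeGreedily S j
      separates {i} {j} e∈ Ti≡Tj with a , ca ← greedy-colours i with b , cb ← greedy-colours j =
        paintAll-proper (edges S) (allFin n) proper e∈
          (inj₂ (a , ca , subst (λ c → greedy j ≡ just c) b≡a cb))
        where b≡a = trans (sym (fromMaybe-just cb)) (trans (sym Ti≡Tj) (fromMaybe-just ca))

    completeGreedily-< : ∀ v → completeGreedily S v < suc s
    completeGreedily-< v with c , cv ← greedy-colours v =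
      subst (_< suc s) (sym (fromMaybe-just cv)) (s≤s (greedy-bounded cv))

    completeFreshly-realises : Realises (completeFreshly S) S
    completeFreshly-realises = record { agrees = fromMaybe-just ; separates = separates }
      where
      fresh-≢ : ∀ {v c} w → colour S v ≡ just c → c ≢ suc s + toℕ w
      fresh-≢ w cv = <⇒≢ (s≤s (≤-trans (bounded cv) (m≤m+n s (toℕ w))))
      separates : ∀ {i j} → (i , j) ∈ edges S → completeFreshly S i ≢ completeFreshly S j
      separates {i} {j} e∈ Ti≡Tj with colour S i in ci | colour S j in cj
      ... | just a  | just _  = proper e∈ (inj₂ (a , ci , subst (λ c → colour S j ≡ just c) (sym Ti≡Tj) cj))
      ... | just _  | nothing = fresh-≢ j ci Ti≡Tj
      ... | nothing | just _  = fresh-≢ i cj (sym Ti≡Tj)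
      ... | nothing | nothing = proper e∈ (inj₁ (toℕ-injective (+-cancelˡ-≡ (suc s) _ _ Ti≡Tj)))

    colouredCount-≤ : s * colouredCount S ≤ 2 * length (edges S)
    colouredCount-≤ = begin
      s * colouredCount S                                ≡⟨ *-distribˡ-sum s (χ ∘ ¬? ∘ uncoloured? (colour S)) ⟩
      sum (λ v → s * χ (¬? (uncoloured? (colour S) v)))  ≤⟨ sum-mono-≤ coloured⇒heavy ⟩
      sum (degree (edges S))                             ≡⟨ sum-degree (edges S) ⟩
      2 * length (edges S)                               ∎
      where
      open ≤-Reasoning
      coloured⇒heavy : ∀ v → s * χ (¬? (uncoloured? (colour S) v)) ≤ degree (edges S) v
      coloured⇒heavy v with colour S v in cv
      ... | nothing = subst (_≤ degree (edges S) v) (sym (*-zeroʳ s)) z≤n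
      ... | just _  = subst (_≤ degree (edges S) v) (sym (*-identityʳ s)) (heavy cv)

    completeFreshly-distinct : 0 < s → 8 * length (edges S) ≤ n * suc s →
                               n ≤ 2 * distinct _≟_ (completeFreshly S)
    completeFreshly-distinct 0<s few-edges = begin
      n                                     ≤⟨ n≤2u {a = colouredCount S} (uncoloured+coloured S) few-coloured ⟩
      2 * uncolouredCount S                 ≤⟨ *-monoʳ-≤ 2 (uncolouredCount-≤ S) ⟩
      2 * distinct _≟_ (completeFreshly S)  ∎
      where
      open ≤-Reasoning
      few-coloured = 2a≤n {e = length (edges S)} 0<s colouredCount-≤ few-edges

theorem9 : (n σ : ℕ) → 2 ≤ σ → 2 * σ < n →
    ¬ (Σ (Algo n) λ alg → WithinBudget σ alg × Distinguishes σ alg)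
theorem9 n (suc s) (s≤s 0<s) _ (alg , within-budget , distinguishes) = true≢false
  where
  open Adversary n s
  S = final (play alg empty)
  inv = play-invariant alg (empty-invariant 0<s)
  T₁ = completeGreedily S
  T₂ = completeFreshly S
  run₁ = proj₁ (play-realises alg empty (completeGreedily-realises inv))
  run₂ = proj₁ (play-realises alg empty (completeFreshly-realises inv))
  cost₂ = proj₂ (play-realises alg empty (completeFreshly-realises inv))

  few-edges : 8 * length (edges S) ≤ n * suc s
  few-edges = begin
    8 * length (edges S)          ≤⟨ *-monoʳ-≤ 8 (length-edges-play alg empty) ⟩
    8 * queries (play alg empty)  ≡⟨ cong (8 *_) cost₂ ⟨
    8 * cost _≟_ alg T₂           ≤⟨ within-budget ℕ _≟_ T₂ ⟩
    n * suc s                     ∎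
    where open ≤-Reasoning

  T₁-accepted : run _≟_ alg T₁ ≡ true
  T₁-accepted = proj₁ (distinguishes ℕ _≟_ T₁) (distinct-≤ T₁ (completeGreedily-< inv))

  T₂-rejected : run _≟_ alg T₂ ≡ false
  T₂-rejected = proj₂ (distinguishes ℕ _≟_ T₂) (completeFreshly-distinct inv 0<s few-edges)

  true≢false : ⊥
  true≢false with () ← trans (sym T₁-accepted) (trans run₁ (trans (sym run₂) T₂-rejected))
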